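{- Let $q$ be a prime power. If $M$ is a multiset of size $nq$ in $\mathrm{AG}(2,q)$ having exactly one special direction, then $M$ is the union of $n$ not necessarily distinct parallel lines.
   Context: Points of $\mathrm{AG}(2,q)$ are the vectors in $\mathbb F_q^2$; lines with slope $d\in\mathbb F_q$ are $Y=dX+b$ and lines with slope $\infty$ are $X+b=0$; directions are $(d)$, $d\in\mathbb F_q\cup\{\infty\}$. Sizes and intersection numbers of multisets count multiplicities. A direction $(d)$ is special for $M$ if not every line of slope $d$ contains $\lfloor|M|/q\rfloor$ or $\lceil|M|/q\rceil$ points of $M$. The union of lines $\ell_1,\dots,\ell_n$ is the multiset where each point has multiplicity the number of $i$ with the point on $\ell_i$. -}

module Defs where

open import Data.Nat using (ℕ; zero; suc; NonZero) renaming (_+_ to _+ℕ_; _*_ to _*ℕ_; _∸_ to _∸ℕ_)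
open import Data.Nat.DivMod using (_/_)
open import Data.Fin using (Fin; zero; suc)
open import Data.Bool using (Bool; true; false; if_then_else_)
open import Data.Maybe using (Maybe; just; nothing)
open import Data.Product using (Σ; _×_; _,_; ∃)
open import Relation.Nullary using (¬_; Dec; yes; no)
open import Relation.Nullary.Decidable using (⌊_⌋)
open import Relation.Binary.PropositionalEquality using (_≡_; _≢_)
open import Algebra.Structures using (IsCommutativeRing)
open import Function.Bundles using (_↔_; Inverse)

sumFin : (n : ℕ) → (Fin n → ℕ) → ℕ
sumFin zero    f = 0
sumFin (suc n) f = f zero +ℕ sumFin n (λ i → f (suc i))

-- A finite field with exactly q elements (so it is F_q; q is then a prime power).
record FiniteField (q : ℕ) : Set₁ where
  field
    Carrier : Set
    _+_ _*_ : Carrier → Carrier → Carrier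
    -_      : Carrier → Carrier
    0# 1#   : Carrier
    isCommutativeRing : IsCommutativeRing _≡_ _+_ _*_ -_ 0# 1#
    0≢1     : 0# ≢ 1#
    inverse : ∀ x → x ≢ 0# → ∃ λ y → x * y ≡ 1#
    _≟_     : (x y : Carrier) → Dec (x ≡ y)
    card    : Fin q ↔ Carrier

  enum : Fin q → Carrier
  enum = Inverse.to card

module AG {q : ℕ} (F : FiniteField q) where
  open FiniteField F

  Point : Set
  Point = Carrier × Carrier

  -- Directions (d), d ∈ F_q ∪ {∞}; nothing = ∞.
  Direction : Set
  Direction = Maybe Carrier

  onLine : Direction → Carrier → Point → Bool
  onLine (just d) b (x , y) = ⌊ y ≟ ((d * x) + b) ⌋
  onLine nothing  b (x , y) = ⌊ (x + b) ≟ 0# ⌋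

  Multiset : Set
  Multiset = Point → ℕ

  sumPoints : (Point → ℕ) → ℕ
  sumPoints f = sumFin q (λ i → sumFin q (λ j → f (enum i , enum j)))

  size : Multiset → ℕ
  size M = sumPoints M

  lineCount : Multiset → Direction → Carrier → ℕ
  lineCount M dir b = sumPoints (λ p → if onLine dir b p then M p else 0)

  ceilDiv : (m n : ℕ) → .{{NonZero n}} → ℕ
  ceilDiv m n = (m +ℕ (n ∸ℕ 1)) / n

  Special : .{{NonZero q}} → Multiset → Direction → Set
  Special M dir = Σ Carrier λ b →
    ¬ (lineCount M dir b ≡ size M / q) × ¬ (lineCount M dir b ≡ ceilDiv (size M) q)

  unionOfLines : (n : ℕ) → Direction → (Fin n → Carrier) → Multiset
  unionOfLines n dir b p = sumFin n (λ i → if onLine dir (b i) p then 1 else 0)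

{-# OPTIONS --safe #-}
-- Let (d) be the special direction. Every other direction is non-special, so each of its lines
-- meets M in exactly n points. Choose coordinates in which the lines of direction (d) are the
-- rows y = const, and fix a point P = (x₀, y₀). The q non-vertical lines through P cover P
-- q times and every point off the column of P exactly once. Counting their points line by line
-- gives (q − 1) n + |row of P ∩ M|; counting column by column gives q M(P) + (q − 1) n.
-- Hence q M(P) = |row of P ∩ M|: M is constant along each line of direction (d), i.e. it is
-- the union of these lines taken with multiplicities, and the multiplicities add up to the
-- number n of points on a column.
module Submission where

open import Defs
open import Data.Nat using (ℕ; NonZero; _*_)
open import Data.Fin using (Fin)
open import Data.Product using (Σ; _×_; _,_)
open import Relation.Binary.PropositionalEquality using (_≡_)

open import Data.Nat using (zero; suc)
import Data.Nat as ℕ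
import Data.Nat.Properties as ℕ
open import Data.Nat.DivMod using (_/_; m*n/n≡m; +-distrib-/-∣ˡ; m<n⇒m/n≡0)
open import Data.Nat.Divisibility using (divides)
open import Data.Fin using (zero; suc; punchIn)
import Data.Fin.Properties as Fin
open import Data.Fin.Permutation using (permutation)
open import Data.Bool using (if_then_else_)
open import Data.Maybe using (just; nothing)
open import Data.Maybe.Properties using (just-injective)
open import Data.Product using (proj₁; proj₂)
open import Function.Base using (_∘_; id)
open import Function.Bundles using (Inverse; Equivalence; _⇔_; mk⇔)
open import Relation.Nullary using (¬_; Dec; yes; no; contradiction)
open import Relation.Nullary.Decidable using (⌊_⌋; isYes≗does; does-⇔; ⌊⌋-map′)
open import Relation.Unary using (Pred; Decidable)
open import Relation.Binary.PropositionalEquality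
  using (_≢_; refl; sym; trans; cong; cong₂; module ≡-Reasoning)
open import Algebra.Bundles using (CommutativeRing)
import Algebra.Properties.CommutativeMonoid.Sum as MonoidSum
import Algebra.Properties.AbelianGroup as AbelianGroupProperties
import Algebra.Properties.Ring as RingProperties

open MonoidSum ℕ.+-0-commutativeMonoid
  using (sum; sum-cong-≗; sum-remove; sum-permute; sum-replicate-zero)
open ≡-Reasoning

isYes-⇔ : ∀ {a b} {A : Set a} {B : Set b} → A ⇔ B → (a? : Dec A) (b? : Dec B) →
  ⌊ a? ⌋ ≡ ⌊ b? ⌋
isYes-⇔ A⇔B a? b? = trans (isYes≗does a?) (trans (does-⇔ A⇔B a? b?) (sym (isYes≗does b?)))

ceilDiv-* : ∀ n q .{{_ : NonZero q}} → (n * q ℕ.+ (q ℕ.∸ 1)) / q ≡ n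
ceilDiv-* n (suc q) = begin
  (n * suc q ℕ.+ q) / suc q        ≡⟨ +-distrib-/-∣ˡ q (divides n refl) ⟩
  n * suc q / suc q ℕ.+ q / suc q  ≡⟨ cong₂ ℕ._+_ (m*n/n≡m n (suc q)) (m<n⇒m/n≡0 (ℕ.n<1+n q)) ⟩
  n ℕ.+ 0                          ≡⟨ ℕ.+-identityʳ n ⟩
  n                                ∎

sumFin≡sum : ∀ n (f : Fin n → ℕ) → sumFin n f ≡ sum f
sumFin≡sum zero    f = refl
sumFin≡sum (suc n) f = cong (f zero ℕ.+_) (sumFin≡sum n (f ∘ suc))

sum-const : ∀ n c → sum {n} (λ _ → c) ≡ n * c
sum-const zero    c = refl
sum-const (suc n) c = cong (c ℕ.+_) (sum-const n c)

sum-except : ∀ {n} (f : Fin n → ℕ) c i → (∀ j → j ≢ i → f j ≡ c) →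
  sum f ℕ.+ c ≡ f i ℕ.+ n * c
sum-except {suc n} f c i off = begin
  sum f ℕ.+ c                        ≡⟨ cong (ℕ._+ c) (sum-remove {i = i} f) ⟩
  f i ℕ.+ sum (f ∘ punchIn i) ℕ.+ c  ≡⟨ cong (λ s → f i ℕ.+ s ℕ.+ c) sum-off-i ⟩
  f i ℕ.+ n * c ℕ.+ c                ≡⟨ ℕ.+-assoc (f i) (n * c) c ⟩
  f i ℕ.+ (n * c ℕ.+ c)              ≡⟨ cong (f i ℕ.+_) (ℕ.+-comm (n * c) c) ⟩
  f i ℕ.+ suc n * c                  ∎
  where
  sum-off-i : sum (f ∘ punchIn i) ≡ n * c
  sum-off-i = trans (sum-cong-≗ (λ j → off (punchIn i j) (Fin.punchInᵢ≢i i j))) (sum-const n c)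

indicator : ∀ {k} → Fin k → Fin k → ℕ
indicator j j′ = if ⌊ j′ Fin.≟ j ⌋ then 1 else 0

occurrences : ∀ {n k} → (Fin n → Fin k) → Fin k → ℕ
occurrences t j = sum (indicator j ∘ t)

prependZeros : ∀ {k r} a → (Fin r → Fin (suc k)) → Fin (a ℕ.+ r) → Fin (suc k)
prependZeros zero    t i       = t i
prependZeros (suc a) t zero    = zero
prependZeros (suc a) t (suc i) = prependZeros a t i

sum-prependZeros : ∀ {k r} a (t : Fin r → Fin (suc k)) (g : Fin (suc k) → ℕ) →
  sum (g ∘ prependZeros a t) ≡ a * g zero ℕ.+ sum (g ∘ t)
sum-prependZeros zero    t g = refl
sum-prependZeros (suc a) t g =
  trans (cong (g zero ℕ.+_) (sum-prependZeros a t g)) (sym (ℕ.+-assoc (g zero) _ _))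

tupleWithMultiplicities : ∀ {k} (m : Fin k → ℕ) → Fin (sum m) → Fin k
tupleWithMultiplicities {suc k} m =
  prependZeros (m zero) (suc ∘ tupleWithMultiplicities (m ∘ suc))

occurrences-tupleWithMultiplicities : ∀ {k} (m : Fin k → ℕ) j →
  occurrences (tupleWithMultiplicities m) j ≡ m j
occurrences-tupleWithMultiplicities {suc k} m zero = begin
  occurrences (tupleWithMultiplicities m) zero
    ≡⟨ sum-prependZeros (m zero) (suc ∘ t) (indicator zero) ⟩
  m zero * 1 ℕ.+ sum (λ i → indicator zero (suc (t i)))
    ≡⟨ cong₂ ℕ._+_ (ℕ.*-identityʳ (m zero)) (sum-replicate-zero (sum (m ∘ suc))) ⟩
  m zero ℕ.+ 0
    ≡⟨ ℕ.+-identityʳ (m zero) ⟩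
  m zero ∎
  where
  t = tupleWithMultiplicities (m ∘ suc)
occurrences-tupleWithMultiplicities {suc k} m (suc j) = begin
  occurrences (tupleWithMultiplicities m) (suc j)
    ≡⟨ sum-prependZeros (m zero) (suc ∘ t) (indicator (suc j)) ⟩
  m zero * 0 ℕ.+ sum (λ i → indicator (suc j) (suc (t i)))
    ≡⟨ cong₂ ℕ._+_ (ℕ.*-zeroʳ (m zero)) (sum-cong-≗ shift) ⟩
  occurrences t j
    ≡⟨ occurrences-tupleWithMultiplicities (m ∘ suc) j ⟩
  m (suc j) ∎
  where
  t = tupleWithMultiplicities (m ∘ suc)
  shift : ∀ i → indicator (suc j) (suc (t i)) ≡ indicator j (t i)
  shift i = cong (λ b → if b then 1 else 0) (⌊⌋-map′ _ _ (t i Fin.≟ j))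

module Plane {q : ℕ} .{{_ : NonZero q}} (F : FiniteField q) where
  open FiniteField F using (Carrier; _≟_; inverse; isCommutativeRing; enum; card)
  open AG F

  commutativeRing : CommutativeRing _ _
  commutativeRing = record { isCommutativeRing = isCommutativeRing }

  open CommutativeRing commutativeRing
    using ( _+_; _-_; -_; 0#; 1#; +-comm; +-assoc; +-identityˡ; +-identityʳ; -‿inverseʳ
          ; *-assoc; *-comm; *-identityˡ; zeroˡ; zeroʳ; distribʳ; +-abelianGroup; ring )
    renaming (_*_ to infixl 7 _·_)
  open AbelianGroupProperties +-abelianGroup
    using ( \\-leftDividesˡ; \\-leftDividesʳ; xyx⁻¹≈y; x∙y⁻¹≈ε⇒x≈y; inverseʳ-unique
          ; identityʳ-unique; ⁻¹-involutive )
  open RingProperties ring using (x[y-z]≈xy-xz; [y-z]x≈yx-zx)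

  from : Carrier → Fin q
  from = Inverse.from card

  enum-from : ∀ x → enum (from x) ≡ x
  enum-from = Inverse.strictlyInverseˡ card

  from-enum : ∀ i → from (enum i) ≡ i
  from-enum = Inverse.strictlyInverseʳ card

  ≡from⇔enum≡ : ∀ {i x} → (i ≡ from x) ⇔ (enum i ≡ x)
  ≡from⇔enum≡ {i} {x} =
    mk⇔ (λ e → trans (cong enum e) (enum-from x)) (λ e → trans (sym (from-enum i)) (cong from e))

  cancel-inverse : ∀ {a w} → w · a ≡ 1# → ∀ u → w · (a · u) ≡ u
  cancel-inverse {a} {w} wa≡1 u = begin
    w · (a · u)  ≡⟨ *-assoc w a u ⟨
    w · a · u    ≡⟨ cong (_· u) wa≡1 ⟩
    1# · u       ≡⟨ *-identityˡ u ⟩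
    u            ∎

  ∑ : (Carrier → ℕ) → ℕ
  ∑ f = sum (f ∘ enum)

  ∑-cong : ∀ {f g} → (∀ x → f x ≡ g x) → ∑ f ≡ ∑ g
  ∑-cong f≗g = sum-cong-≗ (f≗g ∘ enum)

  ∑-const : ∀ c → ∑ (λ _ → c) ≡ q * c
  ∑-const = sum-const q

  ∑-comm : ∀ (f : Carrier → Carrier → ℕ) → ∑ (λ x → ∑ (f x)) ≡ ∑ (λ y → ∑ (λ x → f x y))
  ∑-comm f = MonoidSum.∑-comm ℕ.+-0-commutativeMonoid (λ i j → f (enum i) (enum j))

  sumPoints≡∑∑ : ∀ f → sumPoints f ≡ ∑ (λ x → ∑ (λ y → f (x , y)))
  sumPoints≡∑∑ f =
    trans (sumFin≡sum q _) (sum-cong-≗ (λ i → sumFin≡sum q (λ j → f (enum i , enum j))))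

  ∑-except : ∀ v c (f : Carrier → ℕ) → (∀ x → x ≢ v → f x ≡ c) → ∑ f ℕ.+ c ≡ f v ℕ.+ q * c
  ∑-except v c f off = begin
    ∑ f ℕ.+ c                    ≡⟨ sum-except (f ∘ enum) c (from v) off-from-v ⟩
    f (enum (from v)) ℕ.+ q * c  ≡⟨ cong (λ x → f x ℕ.+ q * c) (enum-from v) ⟩
    f v ℕ.+ q * c                ∎
    where
    off-from-v : ∀ j → j ≢ from v → f (enum j) ≡ c
    off-from-v j j≢ = off (enum j) (j≢ ∘ Equivalence.from ≡from⇔enum≡)

  ∑-single : ∀ v (f : Carrier → ℕ) → (∀ x → x ≢ v → f x ≡ 0) → ∑ f ≡ f v
  ∑-single v f off = begin
    ∑ f             ≡⟨ ℕ.+-identityʳ (∑ f) ⟨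
    ∑ f ℕ.+ 0       ≡⟨ ∑-except v 0 f off ⟩
    f v ℕ.+ q * 0   ≡⟨ cong (f v ℕ.+_) (ℕ.*-zeroʳ q) ⟩
    f v ℕ.+ 0       ≡⟨ ℕ.+-identityʳ (f v) ⟩
    f v             ∎

  ∑-if : ∀ {p} {P : Pred Carrier p} (P? : Decidable P) (f : Carrier → ℕ) {v} →
    (∀ x → P x → x ≡ v) → P v → ∑ (λ x → if ⌊ P? x ⌋ then f x else 0) ≡ f v
  ∑-if P? f {v} only-v Pv = trans (∑-single v f|P off) at-v
    where
    f|P : Carrier → ℕ
    f|P x = if ⌊ P? x ⌋ then f x else 0
    off : ∀ x → x ≢ v → f|P x ≡ 0
    off x x≢v with P? x
    ... | yes Px = contradiction (only-v x Px) x≢v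
    ... | no _   = refl
    at-v : f|P v ≡ f v
    at-v with P? v
    ... | yes _  = refl
    ... | no ¬Pv = contradiction Pv ¬Pv

  ∑-bijection : ∀ (g h : Carrier → Carrier) → (∀ y → g (h y) ≡ y) → (∀ x → h (g x) ≡ x) →
    ∀ f → ∑ (f ∘ g) ≡ ∑ f
  ∑-bijection g h gh hg f = sym (begin
    ∑ f                               ≡⟨ sum-permute (f ∘ enum) π ⟩
    sum (f ∘ enum ∘ from ∘ g ∘ enum)  ≡⟨ sum-cong-≗ (λ i → cong f (enum-from (g (enum i)))) ⟩
    ∑ (f ∘ g)                         ∎)
    where
    onFin : ∀ g h → (∀ y → g (h y) ≡ y) → ∀ j → from (g (enum (from (h (enum j))))) ≡ j
    onFin g h gh j =
      trans (cong (from ∘ g) (enum-from _)) (trans (cong from (gh (enum j))) (from-enum j))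
    π = permutation (from ∘ g ∘ enum) (from ∘ h ∘ enum) (onFin g h gh) (onFin h g hg)

  ∑-translate : ∀ b f → ∑ (λ u → f (b + u)) ≡ ∑ f
  ∑-translate b = ∑-bijection (b +_) (- b +_) (\\-leftDividesˡ b) (\\-leftDividesʳ b)

  ∑-scale : ∀ {a} → a ≢ 0# → ∀ f → ∑ (λ u → f (a · u)) ≡ ∑ f
  ∑-scale {a} a≢0 =
    ∑-bijection (a ·_) (w ·_) (cancel-inverse aw≡1) (cancel-inverse (trans (*-comm w a) aw≡1))
    where
    w = proj₁ (inverse a a≢0)
    aw≡1 = proj₂ (inverse a a≢0)

  ∑-affine : ∀ b {a} → a ≢ 0# → ∀ f → ∑ (λ u → f (b + a · u)) ≡ ∑ f
  ∑-affine b a≢0 f = trans (∑-scale a≢0 (λ z → f (b + z))) (∑-translate b f)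

  point-slope : ∀ x₀ y₀ u x → y₀ + (x - x₀) · u ≡ u · x + (y₀ - u · x₀)
  point-slope x₀ y₀ u x = begin
    y₀ + (x - x₀) · u          ≡⟨ cong (y₀ +_) ([y-z]x≈yx-zx u x x₀) ⟩
    y₀ + (x · u - x₀ · u)      ≡⟨ +-comm y₀ _ ⟩
    x · u - x₀ · u + y₀        ≡⟨ +-assoc (x · u) (- (x₀ · u)) y₀ ⟩
    x · u + (- (x₀ · u) + y₀)  ≡⟨ cong₂ _+_ (*-comm x u) (+-comm _ y₀) ⟩
    u · x + (y₀ - x₀ · u)      ≡⟨ cong (λ z → u · x + (y₀ - z)) (*-comm x₀ u) ⟩
    u · x + (y₀ - u · x₀)      ∎

  module _ (N : Carrier → Carrier → ℕ) (n : ℕ)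
           (columns : ∀ x → ∑ (N x) ≡ n)
           (slanted : ∀ u c → u ≢ 0# → ∑ (λ x → N x (u · x + c)) ≡ n) where

    q*N≡row : ∀ x₀ y₀ → q * N x₀ y₀ ≡ ∑ (λ x → N x y₀)
    q*N≡row x₀ y₀ = ℕ.+-cancelʳ-≡ (q * n) _ _ (begin
      q * N x₀ y₀ ℕ.+ q * n            ≡⟨ by-column ⟨
      ∑ (λ x → ∑ (λ u → G u x)) ℕ.+ n  ≡⟨ cong (ℕ._+ n) (∑-comm (λ x u → G u x)) ⟩
      ∑ (λ u → ∑ (G u)) ℕ.+ n          ≡⟨ by-slope ⟩
      ∑ (λ x → N x y₀) ℕ.+ q * n       ∎)
      where
      G : Carrier → Carrier → ℕ
      G u x = N x (y₀ + (x - x₀) · u)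

      by-slope : ∑ (λ u → ∑ (G u)) ℕ.+ n ≡ ∑ (λ x → N x y₀) ℕ.+ q * n
      by-slope = trans (∑-except 0# n (λ u → ∑ (G u)) slanted-through)
                       (cong (ℕ._+ q * n) (∑-cong (λ x → cong (N x) (horizontal x))))
        where
        slanted-through : ∀ u → u ≢ 0# → ∑ (G u) ≡ n
        slanted-through u u≢0 =
          trans (∑-cong (λ x → cong (N x) (point-slope x₀ y₀ u x))) (slanted u _ u≢0)
        horizontal : ∀ x → y₀ + (x - x₀) · 0# ≡ y₀
        horizontal x = trans (cong (y₀ +_) (zeroʳ _)) (+-identityʳ y₀)

      by-column : ∑ (λ x → ∑ (λ u → G u x)) ℕ.+ n ≡ q * N x₀ y₀ ℕ.+ q * n
      by-column = trans (∑-except x₀ n (λ x → ∑ (λ u → G u x)) other-column)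
                        (cong (ℕ._+ q * n) (trans (∑-cong (λ u → cong (N x₀) (at-x₀ u))) (∑-const _)))
        where
        other-column : ∀ x → x ≢ x₀ → ∑ (λ u → G u x) ≡ n
        other-column x x≢x₀ = trans (∑-affine y₀ (x≢x₀ ∘ x∙y⁻¹≈ε⇒x≈y x x₀) (N x)) (columns x)
        at-x₀ : ∀ u → y₀ + (x₀ - x₀) · u ≡ y₀
        at-x₀ u = trans (cong (λ z → y₀ + z · u) (-‿inverseʳ x₀))
                        (trans (cong (y₀ +_) (zeroˡ u)) (+-identityʳ y₀))

    constant-on-rows : ∀ x x′ y → N x y ≡ N x′ y
    constant-on-rows x x′ y = ℕ.*-cancelˡ-≡ _ _ q (trans (q*N≡row x y) (sym (q*N≡row x′ y)))

  lineThrough : Direction → Point → Carrier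
  lineThrough (just d) (x , y) = - (d · x) + y
  lineThrough nothing  (x , y) = - x

  onLine≡isYes-lineThrough : ∀ d c p → onLine d c p ≡ ⌊ c ≟ lineThrough d p ⌋
  onLine≡isYes-lineThrough (just d) c (x , y) =
    isYes-⇔ (mk⇔ solve-for-c plug-in) (y ≟ (d · x + c)) (c ≟ (- (d · x) + y))
    where
    solve-for-c : y ≡ d · x + c → c ≡ - (d · x) + y
    solve-for-c y≡ = trans (sym (\\-leftDividesʳ (d · x) c)) (cong (- (d · x) +_) (sym y≡))
    plug-in : c ≡ - (d · x) + y → y ≡ d · x + c
    plug-in c≡ = trans (sym (\\-leftDividesˡ (d · x) y)) (cong (d · x +_) (sym c≡))
  onLine≡isYes-lineThrough nothing c (x , y) =
    isYes-⇔ (mk⇔ solve-for-c plug-in) ((x + c) ≟ 0#) (c ≟ (- x))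
    where
    solve-for-c : x + c ≡ 0# → c ≡ - x
    solve-for-c = inverseʳ-unique x c
    plug-in : c ≡ - x → x + c ≡ 0#
    plug-in c≡ = trans (cong (x +_) c≡) (-‿inverseʳ x)

  module _ (M : Multiset) where

    lineCount≡∑∑ : ∀ d c →
      lineCount M d c ≡ ∑ (λ x → ∑ (λ y → if onLine d c (x , y) then M (x , y) else 0))
    lineCount≡∑∑ d c = sumPoints≡∑∑ (λ p → if onLine d c p then M p else 0)

    lineCount-slope : ∀ t c → lineCount M (just t) c ≡ ∑ (λ x → M (x , t · x + c))
    lineCount-slope t c = trans (lineCount≡∑∑ (just t) c)
      (∑-cong (λ x → ∑-if (_≟ (t · x + c)) (λ y → M (x , y)) (λ _ → id) refl))

    lineCount-vertical : ∀ x → lineCount M nothing (- x) ≡ ∑ (λ y → M (x , y))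
    lineCount-vertical x = begin
      lineCount M nothing (- x)
        ≡⟨ lineCount≡∑∑ nothing (- x) ⟩
      ∑ (λ x′ → ∑ (λ y → on-column x′ y))
        ≡⟨ ∑-comm on-column ⟩
      ∑ (λ y → ∑ (λ x′ → on-column x′ y))
        ≡⟨ ∑-cong (λ y → ∑-if column? (λ x′ → M (x′ , y)) only-x (-‿inverseʳ x)) ⟩
      ∑ (λ y → M (x , y)) ∎
      where
      on-column : Carrier → Carrier → ℕ
      on-column x′ y = if onLine nothing (- x) (x′ , y) then M (x′ , y) else 0
      column? : Decidable (λ x′ → x′ - x ≡ 0#)
      column? x′ = (x′ - x) ≟ 0#
      only-x : ∀ x′ → x′ - x ≡ 0# → x′ ≡ x
      only-x x′ = x∙y⁻¹≈ε⇒x≈y x′ x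

    lineCount≡n : ∀ {n} → size M ≡ n * q → ∀ d → ¬ Special M d → ∀ c → lineCount M d c ≡ n
    lineCount≡n {n} |M|≡nq d ¬special c
      with lineCount M d c ℕ.≟ size M / q | lineCount M d c ℕ.≟ ceilDiv (size M) q
    ... | yes ≡⌊|M|/q⌋ | _ = trans ≡⌊|M|/q⌋ (trans (cong (_/ q) |M|≡nq) (m*n/n≡m n q))
    ... | no _ | yes ≡⌈|M|/q⌉ =
      trans ≡⌈|M|/q⌉ (trans (cong (λ s → ceilDiv s q) |M|≡nq) (ceilDiv-* n q))
    ... | no ≢⌊|M|/q⌋ | no ≢⌈|M|/q⌉ = contradiction (c , ≢⌊|M|/q⌋ , ≢⌈|M|/q⌉) ¬special

    WeightedParallelLines : ℕ → Direction → Set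
    WeightedParallelLines n d =
      Σ (Carrier → ℕ) λ m → ∑ m ≡ n × (∀ p → M p ≡ m (lineThrough d p))

    weightedParallelLines : ∀ {n} d → (∀ d′ → d′ ≢ d → ∀ c → lineCount M d′ c ≡ n) →
      WeightedParallelLines n d
    weightedParallelLines {n} (just s) regular = N 0# , columns 0# , M≡N0
      where
      N : Carrier → Carrier → ℕ
      N x b = M (x , s · x + b)

      columns : ∀ x → ∑ (N x) ≡ n
      columns x = begin
        ∑ (N x)                    ≡⟨ ∑-translate (s · x) (λ y → M (x , y)) ⟩
        ∑ (λ y → M (x , y))        ≡⟨ lineCount-vertical x ⟨
        lineCount M nothing (- x)  ≡⟨ regular nothing (λ ()) (- x) ⟩
        n                          ∎

      slanted : ∀ u c → u ≢ 0# → ∑ (λ x → N x (u · x + c)) ≡ n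
      slanted u c u≢0 = begin
        ∑ (λ x → N x (u · x + c))          ≡⟨ ∑-cong (λ x → cong (λ y → M (x , y)) (slope-sum x)) ⟩
        ∑ (λ x → M (x , (s + u) · x + c))  ≡⟨ lineCount-slope (s + u) c ⟨
        lineCount M (just (s + u)) c       ≡⟨ regular (just (s + u)) s+u≢s c ⟩
        n                                  ∎
        where
        slope-sum : ∀ x → s · x + (u · x + c) ≡ (s + u) · x + c
        slope-sum x = trans (sym (+-assoc (s · x) (u · x) c)) (cong (_+ c) (sym (distribʳ x s u)))
        s+u≢s : just (s + u) ≢ just s
        s+u≢s = u≢0 ∘ identityʳ-unique s u ∘ just-injective

      M≡N0 : ∀ p → M p ≡ N 0# (lineThrough (just s) p)
      M≡N0 (x , y) = begin
        M (x , y)             ≡⟨ cong (λ z → M (x , z)) (\\-leftDividesˡ (s · x) y) ⟨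
        N x (- (s · x) + y)   ≡⟨ constant-on-rows N n columns slanted x 0# _ ⟩
        N 0# (- (s · x) + y)  ∎

    weightedParallelLines {n} nothing regular = m , ∑m≡n , M≡m
      where
      N : Carrier → Carrier → ℕ
      N y x = M (x , y)

      columns : ∀ y → ∑ (N y) ≡ n
      columns y = begin
        ∑ (λ x → M (x , y))           ≡⟨ ∑-cong (λ x → cong (λ z → M (x , z)) (horizontal x)) ⟨
        ∑ (λ x → M (x , 0# · x + y))  ≡⟨ lineCount-slope 0# y ⟨
        lineCount M (just 0#) y       ≡⟨ regular (just 0#) (λ ()) y ⟩
        n                             ∎
        where
        horizontal : ∀ x → 0# · x + y ≡ y
        horizontal x = trans (cong (_+ y) (zeroˡ x)) (+-identityˡ y)

      slanted : ∀ u c → u ≢ 0# → ∑ (λ y → M (u · y + c , y)) ≡ n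
      slanted u c u≢0 = begin
        ∑ (λ y → M (u · y + c , y))       ≡⟨ ∑-cong (λ y → cong₂ (λ a b → M (a , b)) (+-comm (u · y) c) (y≡ y)) ⟩
        ∑ (λ y → g (c + u · y))           ≡⟨ ∑-affine c u≢0 g ⟩
        ∑ g                               ≡⟨ ∑-cong (λ x → cong (λ z → M (x , z)) (x[y-z]≈xy-xz w x c)) ⟩
        ∑ (λ x → M (x , w · x - w · c))   ≡⟨ lineCount-slope w (- (w · c)) ⟨
        lineCount M (just w) (- (w · c))  ≡⟨ regular (just w) (λ ()) (- (w · c)) ⟩
        n                                 ∎
        where
        w = proj₁ (inverse u u≢0)
        uw≡1 = proj₂ (inverse u u≢0)
        g : Carrier → ℕ
        g x = M (x , w · (x - c))
        y≡ : ∀ y → y ≡ w · (c + u · y - c)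
        y≡ y = sym (trans (cong (w ·_) (xyx⁻¹≈y c (u · y)))
                                   (cancel-inverse (trans (*-comm w u) uw≡1) y))

      m : Carrier → ℕ
      m c = M (- c , 0#)

      ∑m≡n : ∑ m ≡ n
      ∑m≡n = trans (∑-bijection -_ -_ ⁻¹-involutive ⁻¹-involutive (λ x → M (x , 0#))) (columns 0#)

      M≡m : ∀ p → M p ≡ m (lineThrough nothing p)
      M≡m (x , y) = begin
        M (x , y)   ≡⟨ constant-on-rows N n columns slanted y 0# x ⟩
        M (x , 0#)  ≡⟨ cong (λ z → M (z , 0#)) (⁻¹-involutive x) ⟨
        m (- x)     ∎

    unionOfLines-weightedParallelLines : ∀ {n} d → WeightedParallelLines n d →
      Σ (Fin n → Carrier) λ b → ∀ p → M p ≡ unionOfLines n d b p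
    unionOfLines-weightedParallelLines d (m , refl , M≡m) = enum ∘ t , M≡union
      where
      t = tupleWithMultiplicities (m ∘ enum)

      M≡union : ∀ p → M p ≡ unionOfLines (∑ m) d (enum ∘ t) p
      M≡union p = begin
        M p                     ≡⟨ M≡m p ⟩
        m ℓ                     ≡⟨ cong m (enum-from ℓ) ⟨
        m (enum (from ℓ))       ≡⟨ occurrences-tupleWithMultiplicities (m ∘ enum) (from ℓ) ⟨
        occurrences t (from ℓ)  ≡⟨ sum-cong-≗ (λ i → cong (λ b → if b then 1 else 0) (on-ℓ (t i))) ⟩
        sum (λ i → if onLine d (enum (t i)) p then 1 else 0)
                                ≡⟨ sumFin≡sum (∑ m) _ ⟨
        unionOfLines (∑ m) d (enum ∘ t) p ∎
        where
        ℓ = lineThrough d p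
        on-ℓ : ∀ j → ⌊ j Fin.≟ from ℓ ⌋ ≡ onLine d (enum j) p
        on-ℓ j = trans (isYes-⇔ ≡from⇔enum≡ (j Fin.≟ from ℓ) (enum j ≟ ℓ))
                       (sym (onLine≡isYes-lineThrough d (enum j) p))

proposition3p2 : (q : ℕ) .{{_ : NonZero q}} (F : FiniteField q) (n : ℕ)
    (M : AG.Multiset F) →
    AG.size F M ≡ n * q →
    Σ (AG.Direction F) (λ d → AG.Special F M d × (∀ d′ → AG.Special F M d′ → d′ ≡ d)) →
    Σ (AG.Direction F) (λ d → Σ (Fin n → FiniteField.Carrier F) (λ b →
      ∀ p → M p ≡ AG.unionOfLines F n d b p))
proposition3p2 q F n M |M|≡nq (d , _ , unique) =
  d , unionOfLines-weightedParallelLines M d (weightedParallelLines M d regular)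
  where
  open Plane F
  regular : ∀ d′ → d′ ≢ d → ∀ c → AG.lineCount F M d′ c ≡ n
  regular d′ d′≢d = lineCount≡n M |M|≡nq d′ (d′≢d ∘ unique d′)
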